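{- Let $\Gamma=\langle S\mid R\rangle$ be a finitely presented sofic group with a generator $\tau\in S$ which is a central non-trivial involution in $\Gamma$. Then there is a sofic approximation $\psi_n\colon S\to\mathrm{Sym}((\Omega_n)_\pm)$ of $\Gamma$ such that $\psi_n(\tau)=-\mathrm{Id}$ for all $n$, and every permutation in the image of $\psi_n$ commutes with $-\mathrm{Id}$.
   Context: For a finite set $\Omega$, $\Omega_\pm=\{+,-\}\times\Omega$ and $-\mathrm{Id}\in\mathrm{Sym}(\Omega_\pm)$ is the sign flip $\pm\star\mapsto\mp\star$. For finite sets $\Omega\subseteq\Sigma$, $d_H(\sigma,\sigma')=\Pr_{\star\in\Sigma}[\sigma.\star\ne\sigma'.\star]$ for $\sigma\in\mathrm{Sym}(\Omega),\sigma'\in\mathrm{Sym}(\Sigma)$ (with $\sigma.\star$ an error symbol for $\star\notin\Omega$). Maps $\varphi\colon S\to\mathrm{Sym}(\Omega)$ extend to words in the free group $\mathcal F_S$; $\mathrm{def}(\varphi)=\max_{r\in R}\Pr_{\star\in\Omega}[\varphi(r).\star\ne\star]$, and $\varphi$ is an $\epsilon$-almost action if $\mathrm{def}(\varphi)\le\epsilon$. A sofic approximation of $\langle S\mid R\rangle$ is a sequence of $\epsilon_n$-almost actions $\varphi_n\colon S\to\mathrm{Sym}(\Omega_n)$ with $\epsilon_n\to0$ such that for every $w\in\mathcal F_S$ not in the normal closure of $R$, $d_H(\varphi_n(w),\mathrm{Id}_{\Omega_n})\to1$; $\Gamma$ is sofic if it has one. -}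

module Defs where

open import Data.Nat using (ℕ; zero; suc; _+_) renaming (_≤_ to _≤ℕ_)
open import Data.Bool using (Bool; true; false; not; if_then_else_)
open import Data.Fin using (Fin; zero; suc; splitAt; _↑ˡ_; _↑ʳ_; _≟_)
open import Data.Fin.Permutation using (Permutation′; _⟨$⟩ʳ_; _⟨$⟩ˡ_)
open import Data.List using (List; []; _∷_; _++_)
open import Data.List.Membership.Propositional using (_∈_)
open import Data.Product using (_×_; _,_; Σ; ∃)
open import Data.Sum using (inj₁; inj₂)
open import Data.Integer using (+_)
open import Data.Rational using (ℚ; 0ℚ; 1ℚ; _/_; _-_; _<_; _≤_)
open import Relation.Nullary using (¬_; does)

-- Words in the free group F_S on the finite generating set S = Fin k.
-- A letter (s , true) stands for s, (s , false) for s⁻¹.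

Letter : ℕ → Set
Letter k = Fin k × Bool

Word : ℕ → Set
Word k = List (Letter k)

letter : ∀ {k} → Fin k → Word k
letter s = (s , true) ∷ []

-- The group Γ = ⟨ S ∣ R ⟩ : equality of words in Γ is the congruence
-- on words generated by free cancellation and the relators.

data _≈⟨_⟩_ {k : ℕ} : Word k → List (Word k) → Word k → Set where
  ≈-refl   : ∀ {R u} → u ≈⟨ R ⟩ u
  ≈-sym    : ∀ {R u v} → u ≈⟨ R ⟩ v → v ≈⟨ R ⟩ u
  ≈-trans  : ∀ {R u v w} → u ≈⟨ R ⟩ v → v ≈⟨ R ⟩ w → u ≈⟨ R ⟩ w
  ≈-cong   : ∀ {R u u′ v v′} → u ≈⟨ R ⟩ u′ → v ≈⟨ R ⟩ v′ →
             (u ++ v) ≈⟨ R ⟩ (u′ ++ v′)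
  ≈-cancel : ∀ {R} (s : Fin k) (b : Bool) →
             ((s , b) ∷ (s , not b) ∷ []) ≈⟨ R ⟩ []
  ≈-rel    : ∀ {R r} → r ∈ R → r ≈⟨ R ⟩ []

InNormalClosure : ∀ {k} → List (Word k) → Word k → Set
InNormalClosure R w = w ≈⟨ R ⟩ []

-- Extending φ : S → Sym(Ω) to words (left action: the rightmost
-- letter acts first, so φ(uv).⋆ = φ(u).(φ(v).⋆)).

actLetter : ∀ {k N} → (Fin k → Permutation′ N) → Letter k → Fin N → Fin N
actLetter φ (s , true)  x = φ s ⟨$⟩ʳ x
actLetter φ (s , false) x = φ s ⟨$⟩ˡ x

evalWord : ∀ {k N} → (Fin k → Permutation′ N) → Word k → Fin N → Fin N
evalWord φ []      x = x
evalWord φ (l ∷ w) x = actLetter φ l (evalWord φ w x)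

-- Uniform probability on Ω = Fin N (N ≥ 1 is required separately).

count : ∀ {N} → (Fin N → Bool) → ℕ
count {zero}  P = 0
count {suc N} P = (if P zero then 1 else 0) + count (λ i → P (suc i))

Pr : (N : ℕ) → (Fin N → Bool) → ℚ
Pr zero    P = 0ℚ
Pr (suc N) P = (+ count P) / suc N

movedFrac : ∀ {N} → (Fin N → Fin N) → ℚ
movedFrac {N} f = Pr N (λ x → not (does (f x ≟ x)))

-- def(φ) = max_{r ∈ R} Pr[φ(r).⋆ ≠ ⋆];  def(φ) ≤ ε  iff every relator
-- moves at most an ε-fraction of points.
DefAtMost : ∀ {k N} → List (Word k) → (Fin k → Permutation′ N) → ℚ → Set
DefAtMost R φ ε = ∀ r → r ∈ R → movedFrac (evalWord φ r) ≤ ε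

record IsSoficApprox {k : ℕ} (R : List (Word k)) (N : ℕ → ℕ)
         (φ : (n : ℕ) → Fin k → Permutation′ (N n)) : Set where
  field
    nonempty   : ∀ n → 1 ≤ℕ N n
    almost     : Σ (ℕ → ℚ) λ ε →
                   (∀ n → DefAtMost R (φ n) (ε n)) ×
                   (∀ (δ : ℚ) → 0ℚ < δ → ∃ λ M → ∀ n → M ≤ℕ n →
                      ε n ≤ δ × (0ℚ - δ) ≤ ε n)
    separating : ∀ (w : Word k) → ¬ InNormalClosure R w →
                 ∀ (δ : ℚ) → 0ℚ < δ → ∃ λ M → ∀ n → M ≤ℕ n →
                   (1ℚ - δ) ≤ movedFrac (evalWord (φ n) w)

IsSofic : ∀ {k} → List (Word k) → Set
IsSofic {k} R = Σ (ℕ → ℕ) λ N → Σ ((n : ℕ) → Fin k → Permutation′ (N n)) λ φ →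
                  IsSoficApprox R N φ

-- Ω_± = {+,-} × Ω realised as Fin (m + m): the first m points are +⋆,
-- the last m points are -⋆.  negId is the sign flip ±⋆ ↦ ∓⋆.

negId : ∀ {m} → Fin (m + m) → Fin (m + m)
negId {m} x with splitAt m x
... | inj₁ i = m ↑ʳ i
... | inj₂ j = j ↑ˡ m

-- Let φ be a sofic approximation. As τ² = 1, τ ≠ 1 and τ is central in Γ, on all but a negligible
-- fraction of points φ(τ) is a fixed-point-free involution commuting with every φ(s); these
-- fractions are controlled by the numbers of relators used in derivations of τ² = 1 and τ s = s τ.
-- On two copies of Ω, keep the 2-cycles of φ(τ) inside each copy and exchange the copies at the
-- remaining points: this is a fixed-point-free involution, and an explicit involution (pairing)
-- conjugates it to −Id. After conjugating the doubled φ(s) alike, send τ to −Id itself and every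
-- other generator to its first-return map to the graph of −Id, a permutation commuting with −Id
-- that agrees with the old one wherever that already commuted with −Id. Every change touches a
-- negligible fraction of points, so the result is again a sofic approximation.

module Submission where

open import Defs
import Algebra.Properties.CommutativeMonoid.Sum as CommutativeMonoidSum
open import Data.Bool using (Bool; true; false; not; _∨_; if_then_else_)
open import Data.Fin as Fin using (Fin; zero; suc; _≟_; _↑ˡ_; _↑ʳ_; splitAt; join; toℕ; combine)
import Data.Fin.Properties as Fin
open import Data.Fin.Permutation
  using (Permutation′; _⟨$⟩ʳ_; _⟨$⟩ˡ_; inverseˡ; inverseʳ; permutation; _∘ₚ_; flip)
  renaming (id to idₚ)
import Data.Integer as ℤ
import Data.Integer.Properties as ℤ
open import Data.List using (List; []; _∷_; _++_; map; length; allFin)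
open import Data.List.Membership.Propositional using (_∈_)
open import Data.List.Membership.Propositional.Properties using (∈-map⁺; ∈-allFin)
open import Data.List.Relation.Unary.Any using (here; there)
open import Data.Nat using (ℕ; zero; suc; _+_; _*_; _∸_; _≤_; _<_; _⊔_; z≤n; s≤s)
open import Data.Nat.ListAction using (sum)
open import Data.Nat.Properties
  using (≤-refl; ≤-reflexive; ≤-trans; ≤-pred; <⇒≤; <⇒≱; <-cmp; ≤∧≢⇒<; n≤1+n; m≤n⇒m≤1+n; n<1+n;
         m≤m+n; m≤n+m; m⊔n≤o⇒m≤o; m⊔n≤o⇒n≤o; +-suc; +-assoc; +-comm; +-identityʳ; +-mono-≤; +-monoˡ-≤;
         +-monoʳ-≤; +-cancelˡ-≤; *-assoc; *-comm; *-zeroʳ; *-distribʳ-+; *-monoˡ-≤; *-monoʳ-≤; *-cancelˡ-≤;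
         m∸n≤m; m+[n∸m]≡n; +-∸-assoc; ∸-monoʳ-<; n∸n≡0; m<n⇒0<n∸m; +-0-commutativeMonoid;
         module ≤-Reasoning)
open import Data.Nat.Solver using (module +-*-Solver)
open import Data.Product using (Σ; ∃-syntax; _×_; _,_; proj₁; proj₂; map₁)
open import Data.Rational as ℚ using (ℚ; 0ℚ; 1ℚ; toℚᵘ)
import Data.Rational.Properties as ℚ
open import Data.Rational.Unnormalised as ℚᵘ using (mkℚᵘ; _≃_)
import Data.Rational.Unnormalised.Properties as ℚᵘ
open import Data.Sum using (_⊎_; inj₁; inj₂; swap) renaming (map to map⊎)
open import Data.Sum.Properties using (swap-involutive)
open import Function using (_∘_; id)
import Function.Endo.Propositional as Endo
open import Relation.Binary.Definitions using (tri<; tri≈; tri>)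
open import Relation.Binary.PropositionalEquality
  using (_≡_; _≢_; refl; sym; trans; cong; cong₂; cong-app; subst; subst₂; _≗_; module ≡-Reasoning)
open import Relation.Nullary using (¬_; does; yes; no; contradiction)
open import Relation.Nullary.Decidable using (dec-true)

open +-*-Solver using (solve; _:+_; _:*_; _:=_; con)

private variable
  k N M : ℕ

-- Counting points

indicator : Bool → ℕ
indicator b = if b then 1 else 0

count-cong : {P Q : Fin N → Bool} → (∀ x → P x ≡ Q x) → count P ≡ count Q
count-cong {zero}  P≗Q = refl
count-cong {suc N} P≗Q = cong₂ _+_ (cong indicator (P≗Q zero)) (count-cong (P≗Q ∘ suc))

count-mono : {P Q : Fin N → Bool} → (∀ x → P x ≡ true → Q x ≡ true) → count P ≤ count Q
count-mono {zero}  P⇒Q = z≤n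
count-mono {suc N} {P} P⇒Q = +-mono-≤ (indicator-mono (P zero) (P⇒Q zero)) (count-mono (P⇒Q ∘ suc))
  where
  indicator-mono : ∀ {b} a → (a ≡ true → b ≡ true) → indicator a ≤ indicator b
  indicator-mono false a⇒b = z≤n
  indicator-mono true  a⇒b rewrite a⇒b refl = ≤-refl

count-∨ : (P Q : Fin N → Bool) → count (λ x → P x ∨ Q x) ≤ count P + count Q
count-∨ {zero}  P Q = z≤n
count-∨ {suc N} P Q = begin
  indicator (P zero ∨ Q zero) + count (λ x → P (suc x) ∨ Q (suc x))
    ≤⟨ +-mono-≤ (indicator-∨ (P zero) (Q zero)) (count-∨ (P ∘ suc) (Q ∘ suc)) ⟩
  (indicator (P zero) + indicator (Q zero)) + (count (P ∘ suc) + count (Q ∘ suc))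
    ≡⟨ interchange (indicator (P zero)) (indicator (Q zero)) (count (P ∘ suc)) (count (Q ∘ suc)) ⟩
  (indicator (P zero) + count (P ∘ suc)) + (indicator (Q zero) + count (Q ∘ suc)) ∎
  where
  open ≤-Reasoning
  indicator-∨ : ∀ a b → indicator (a ∨ b) ≤ indicator a + indicator b
  indicator-∨ false b = ≤-refl
  indicator-∨ true  b = s≤s z≤n
  interchange : ∀ a b c d → (a + b) + (c + d) ≡ (a + c) + (b + d)
  interchange = solve 4 (λ a b c d → (a :+ b) :+ (c :+ d) := (a :+ c) :+ (b :+ d)) refl

count-complement : (P : Fin N → Bool) → count P + count (not ∘ P) ≡ N
count-complement {zero}  P = refl
count-complement {suc N} P with P zero
... | true  = cong suc (count-complement (P ∘ suc))
... | false = trans (+-suc (count (P ∘ suc)) _) (cong suc (count-complement (P ∘ suc)))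

count-false : (P : Fin N → Bool) → (∀ x → P x ≡ false) → count P ≡ 0
count-false {zero}  P P≡false = refl
count-false {suc N} P P≡false rewrite P≡false zero = count-false (P ∘ suc) (P≡false ∘ suc)

count-↑ : (P : Fin (N + M) → Bool) → count P ≡ count (λ i → P (i ↑ˡ M)) + count (λ j → P (N ↑ʳ j))
count-↑ {zero}      P = refl
count-↑ {suc N} {M} P = trans (cong (indicator (P zero) +_) (count-↑ {N} {M} (P ∘ suc)))
                              (sym (+-assoc (indicator (P zero)) _ _))

count-permute : (π : Permutation′ N) (P : Fin N → Bool) → count (λ x → P (π ⟨$⟩ʳ x)) ≡ count P
count-permute π P = begin
  count (P ∘ (π ⟨$⟩ʳ_))             ≡⟨ count≡∑ (P ∘ (π ⟨$⟩ʳ_)) ⟩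
  ∑ (indicator ∘ P ∘ (π ⟨$⟩ʳ_))     ≡⟨ sum-permute (indicator ∘ P) π ⟨
  ∑ (indicator ∘ P)                 ≡⟨ count≡∑ P ⟨
  count P                           ∎
  where
  open ≡-Reasoning
  open CommutativeMonoidSum +-0-commutativeMonoid using (sum-permute) renaming (sum to ∑)
  count≡∑ : ∀ {N} (P : Fin N → Bool) → count P ≡ ∑ (indicator ∘ P)
  count≡∑ {zero}  P = refl
  count≡∑ {suc N} P = cong (indicator (P zero) +_) (count≡∑ (P ∘ suc))

-- Hamming distance

infix 4.5 _≢ᵇ_
_≢ᵇ_ : Fin N → Fin N → Bool
a ≢ᵇ b = not (does (a ≟ b))

≢ᵇ-false⇒≡ : {a b : Fin N} → a ≢ᵇ b ≡ false → a ≡ b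
≢ᵇ-false⇒≡ {a = a} {b} eq with a ≟ b | eq
... | yes a≡b | _ = a≡b
... | no _    | ()

≢ᵇ-true⇒≢ : {a b : Fin N} → a ≢ᵇ b ≡ true → a ≢ b
≢ᵇ-true⇒≢ {a = a} {b} eq with a ≟ b | eq
... | yes _  | ()
... | no a≢b | _ = a≢b

does-true⇒≡ : {a b : Fin N} → does (a ≟ b) ≡ true → a ≡ b
does-true⇒≡ {a = a} {b} eq with a ≟ b | eq
... | yes a≡b | _ = a≡b

≡⇒≢ᵇ-false : {a b : Fin N} → a ≡ b → a ≢ᵇ b ≡ false
≡⇒≢ᵇ-false {a = a} {b} a≡b with a ≟ b
... | yes _  = refl
... | no a≢b = contradiction a≡b a≢b

≢ᵇ-∨ : (a b : Fin N) {c : Bool} → (a ≡ b → c ≡ true) → (a ≢ᵇ b) ∨ c ≡ true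
≢ᵇ-∨ a b a≡b⇒c with a ≟ b
... | yes a≡b = a≡b⇒c a≡b
... | no _    = refl

≢ᵇ-blames : {a b : Fin N} (p : Bool) → (p ≡ false → a ≡ b) → a ≢ᵇ b ≡ true → p ≡ true
≢ᵇ-blames true  _   _  = refl
≢ᵇ-blames false a≡b a≢b = contradiction (a≡b refl) (≢ᵇ-true⇒≢ a≢b)

≢ᵇ-blames₃ : {a b : Fin N} (p q r : Bool) → (p ≡ false → q ≡ false → r ≡ false → a ≡ b) →
             a ≢ᵇ b ≡ true → (p ∨ q) ∨ r ≡ true
≢ᵇ-blames₃ true  q     r     _   _   = refl
≢ᵇ-blames₃ false true  r     _   _   = refl
≢ᵇ-blames₃ false false true  _   _   = refl
≢ᵇ-blames₃ false false false a≡b a≢b = contradiction (a≡b refl refl refl) (≢ᵇ-true⇒≢ a≢b)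

does-sym : (a b : Fin N) → does (a ≟ b) ≡ does (b ≟ a)
does-sym a b with a ≟ b | b ≟ a
... | yes _   | yes _   = refl
... | yes a≡b | no b≢a  = contradiction (sym a≡b) b≢a
... | no a≢b  | yes b≡a = contradiction (sym b≡a) a≢b
... | no _    | no _    = refl

does-injective : (f : Fin N → Fin M) → (∀ {a b} → f a ≡ f b → a ≡ b) →
                 ∀ a b → does (f a ≟ f b) ≡ does (a ≟ b)
does-injective f f-injective a b with f a ≟ f b | a ≟ b
... | yes _     | yes _   = refl
... | yes fa≡fb | no a≢b  = contradiction (f-injective fa≡fb) a≢b
... | no fa≢fb  | yes a≡b = contradiction (cong f a≡b) fa≢fb
... | no _      | no _    = refl

permutation-injective : (π : Permutation′ N) → ∀ {a b} → π ⟨$⟩ʳ a ≡ π ⟨$⟩ʳ b → a ≡ b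
permutation-injective π eq = trans (sym (inverseˡ π)) (trans (cong (π ⟨$⟩ˡ_) eq) (inverseˡ π))

dist : (f g : Fin N → Fin N) → ℕ
dist f g = count (λ x → f x ≢ᵇ g x)

countFix : (Bool → Bool) → (Fin N → Fin N) → ℕ
countFix c f = count (λ x → c (does (f x ≟ x)))

moved fixed : (Fin N → Fin N) → ℕ
moved = countFix not
fixed = countFix id

fixed+moved≡N : (f : Fin N → Fin N) → fixed f + moved f ≡ N
fixed+moved≡N f = count-complement (λ x → does (f x ≟ x))

dist-cong : {f f′ g g′ : Fin N → Fin N} → f ≗ f′ → g ≗ g′ → dist f g ≡ dist f′ g′
dist-cong f≗f′ g≗g′ = count-cong (λ x → cong₂ _≢ᵇ_ (f≗f′ x) (g≗g′ x))

dist-≗ : {f g : Fin N → Fin N} → f ≗ g → dist f g ≡ 0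
dist-≗ f≗g = count-false _ (λ x → ≡⇒≢ᵇ-false (f≗g x))

dist-sym : (f g : Fin N → Fin N) → dist f g ≡ dist g f
dist-sym f g = count-cong (λ x → cong not (does-sym (f x) (g x)))

dist-triangle : (f g h : Fin N → Fin N) → dist f h ≤ dist f g + dist g h
dist-triangle f g h = ≤-trans (count-mono step) (count-∨ (λ x → f x ≢ᵇ g x) (λ x → g x ≢ᵇ h x))
  where
  step : ∀ x → f x ≢ᵇ h x ≡ true → (f x ≢ᵇ g x) ∨ (g x ≢ᵇ h x) ≡ true
  step x fx≢hx = ≢ᵇ-∨ (f x) (g x) (λ fx≡gx → trans (cong (_≢ᵇ h x) (sym fx≡gx)) fx≢hx)

countFix-triangle : (c : Bool → Bool) (f g : Fin N → Fin N) → countFix c f ≤ dist f g + countFix c g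
countFix-triangle c f g =
  ≤-trans (count-mono step) (count-∨ (λ x → f x ≢ᵇ g x) (λ x → c (does (g x ≟ x))))
  where
  step : ∀ x → c (does (f x ≟ x)) ≡ true → (f x ≢ᵇ g x) ∨ c (does (g x ≟ x)) ≡ true
  step x cf = ≢ᵇ-∨ (f x) (g x) (λ fx≡gx → trans (cong (λ y → c (does (y ≟ x))) (sym fx≡gx)) cf)

dist-∘ : (π : Permutation′ N) (f f′ g : Fin N → Fin N) →
         dist (λ x → f (π ⟨$⟩ʳ x)) (λ x → f′ (g x)) ≤ dist (π ⟨$⟩ʳ_) g + dist f f′
dist-∘ π f f′ g = begin
  dist (λ x → f (π ⟨$⟩ʳ x)) (λ x → f′ (g x))
    ≤⟨ count-mono step ⟩
  count (λ x → (π ⟨$⟩ʳ x ≢ᵇ g x) ∨ (f (π ⟨$⟩ʳ x) ≢ᵇ f′ (π ⟨$⟩ʳ x)))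
    ≤⟨ count-∨ (λ x → π ⟨$⟩ʳ x ≢ᵇ g x) (λ x → f (π ⟨$⟩ʳ x) ≢ᵇ f′ (π ⟨$⟩ʳ x)) ⟩
  dist (π ⟨$⟩ʳ_) g + count (λ x → f (π ⟨$⟩ʳ x) ≢ᵇ f′ (π ⟨$⟩ʳ x))
    ≡⟨ cong (dist (π ⟨$⟩ʳ_) g +_) (count-permute π (λ y → f y ≢ᵇ f′ y)) ⟩
  dist (π ⟨$⟩ʳ_) g + dist f f′ ∎
  where
  open ≤-Reasoning
  step : ∀ x → f (π ⟨$⟩ʳ x) ≢ᵇ f′ (g x) ≡ true →
         (π ⟨$⟩ʳ x ≢ᵇ g x) ∨ (f (π ⟨$⟩ʳ x) ≢ᵇ f′ (π ⟨$⟩ʳ x)) ≡ true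
  step x differs = ≢ᵇ-∨ (π ⟨$⟩ʳ x) (g x) (λ πx≡gx → trans (cong (λ y → f (π ⟨$⟩ʳ x) ≢ᵇ f′ y) πx≡gx) differs)

dist-conjugate : (σ : Permutation′ N) (f g : Fin N → Fin N) →
                 dist (λ x → σ ⟨$⟩ˡ f (σ ⟨$⟩ʳ x)) (λ x → σ ⟨$⟩ˡ g (σ ⟨$⟩ʳ x)) ≡ dist f g
dist-conjugate σ f g = trans
  (count-cong (λ x → cong not
    (does-injective (σ ⟨$⟩ˡ_) (permutation-injective (flip σ)) (f (σ ⟨$⟩ʳ x)) (g (σ ⟨$⟩ʳ x)))))
  (count-permute σ (λ y → f y ≢ᵇ g y))

countFix-conjugate : (c : Bool → Bool) (σ : Permutation′ N) (f : Fin N → Fin N) →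
                     countFix c (λ x → σ ⟨$⟩ˡ f (σ ⟨$⟩ʳ x)) ≡ countFix c f
countFix-conjugate c σ f = trans
  (count-cong (λ x → cong c (trans (cong (λ y → does (σ ⟨$⟩ˡ f (σ ⟨$⟩ʳ x) ≟ y)) (sym (inverseˡ σ)))
    (does-injective (σ ⟨$⟩ˡ_) (permutation-injective (flip σ)) (f (σ ⟨$⟩ʳ x)) (σ ⟨$⟩ʳ x)))))
  (count-permute σ (λ y → c (does (f y ≟ y))))

dist-inverse : (π ρ : Permutation′ N) → dist (π ⟨$⟩ˡ_) (ρ ⟨$⟩ˡ_) ≡ dist (π ⟨$⟩ʳ_) (ρ ⟨$⟩ʳ_)
dist-inverse π ρ = trans (sym (count-permute π (λ y → π ⟨$⟩ˡ y ≢ᵇ ρ ⟨$⟩ˡ y)))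
                         (count-cong (λ x → cong not (inverses-agree x)))
  where
  inverses-agree : ∀ x → does (π ⟨$⟩ˡ (π ⟨$⟩ʳ x) ≟ ρ ⟨$⟩ˡ (π ⟨$⟩ʳ x)) ≡ does (π ⟨$⟩ʳ x ≟ ρ ⟨$⟩ʳ x)
  inverses-agree x = begin
    does (π ⟨$⟩ˡ (π ⟨$⟩ʳ x) ≟ ρ ⟨$⟩ˡ (π ⟨$⟩ʳ x))
      ≡⟨ cong (λ y → does (y ≟ ρ ⟨$⟩ˡ (π ⟨$⟩ʳ x))) (trans (inverseˡ π) (sym (inverseˡ ρ))) ⟩
    does (ρ ⟨$⟩ˡ (ρ ⟨$⟩ʳ x) ≟ ρ ⟨$⟩ˡ (π ⟨$⟩ʳ x))
      ≡⟨ does-injective (ρ ⟨$⟩ˡ_) (permutation-injective (flip ρ)) (ρ ⟨$⟩ʳ x) (π ⟨$⟩ʳ x) ⟩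
    does (ρ ⟨$⟩ʳ x ≟ π ⟨$⟩ʳ x)
      ≡⟨ does-sym (ρ ⟨$⟩ʳ x) (π ⟨$⟩ʳ x) ⟩
    does (π ⟨$⟩ʳ x ≟ ρ ⟨$⟩ʳ x) ∎
    where open ≡-Reasoning

-- Words acting through permutations

∈⇒≤sum : {n : ℕ} {ns : List ℕ} → n ∈ ns → n ≤ sum ns
∈⇒≤sum (here refl)  = m≤m+n _ _
∈⇒≤sum (there n∈ns) = ≤-trans (∈⇒≤sum n∈ns) (m≤n+m _ _)

relatorCount : {R : List (Word k)} {u v : Word k} → u ≈⟨ R ⟩ v → ℕ
relatorCount ≈-refl         = 0
relatorCount (≈-sym d)      = relatorCount d
relatorCount (≈-trans d e)  = relatorCount d + relatorCount e
relatorCount (≈-cong d e)   = relatorCount d + relatorCount e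
relatorCount (≈-cancel s b) = 0
relatorCount (≈-rel r∈R)    = 1

module _ (φ : Fin k → Permutation′ N) where

  letterPerm : Letter k → Permutation′ N
  letterPerm (s , true)  = φ s
  letterPerm (s , false) = flip (φ s)

  wordPerm : Word k → Permutation′ N
  wordPerm []      = idₚ
  wordPerm (l ∷ w) = wordPerm w ∘ₚ letterPerm l

  wordPerm-evalWord : ∀ w x → wordPerm w ⟨$⟩ʳ x ≡ evalWord φ w x
  wordPerm-evalWord []                x = refl
  wordPerm-evalWord ((s , true)  ∷ w) x = cong (φ s ⟨$⟩ʳ_) (wordPerm-evalWord w x)
  wordPerm-evalWord ((s , false) ∷ w) x = cong (φ s ⟨$⟩ˡ_) (wordPerm-evalWord w x)

  evalWord-++ : ∀ u v x → evalWord φ (u ++ v) x ≡ evalWord φ u (evalWord φ v x)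
  evalWord-++ []      v x = refl
  evalWord-++ (l ∷ u) v x = cong (actLetter φ l) (evalWord-++ u v x)

  -- Lies between def(φ) · N and |R| · def(φ) · N.
  defect : List (Word k) → ℕ
  defect R = sum (map (λ r → moved (evalWord φ r)) R)

  moved≤defect : {r : Word k} {R : List (Word k)} → r ∈ R → moved (evalWord φ r) ≤ defect R
  moved≤defect r∈R = ∈⇒≤sum (∈-map⁺ (λ r → moved (evalWord φ r)) r∈R)

  dist-evalWord : {R : List (Word k)} {u v : Word k} (d : u ≈⟨ R ⟩ v) →
                  dist (evalWord φ u) (evalWord φ v) ≤ relatorCount d * defect R
  dist-evalWord {u = u} ≈-refl = ≤-reflexive (dist-≗ {f = evalWord φ u} (λ _ → refl))
  dist-evalWord {u = u} {v} (≈-sym d) =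
    ≤-trans (≤-reflexive (dist-sym (evalWord φ u) (evalWord φ v))) (dist-evalWord d)
  dist-evalWord {R = R} {u} {w} (≈-trans {v = v} d e) = begin
    dist (evalWord φ u) (evalWord φ w)
      ≤⟨ dist-triangle (evalWord φ u) (evalWord φ v) (evalWord φ w) ⟩
    dist (evalWord φ u) (evalWord φ v) + dist (evalWord φ v) (evalWord φ w)
      ≤⟨ +-mono-≤ (dist-evalWord d) (dist-evalWord e) ⟩
    relatorCount d * defect R + relatorCount e * defect R
      ≡⟨ *-distribʳ-+ (defect R) (relatorCount d) (relatorCount e) ⟨
    (relatorCount d + relatorCount e) * defect R ∎
    where open ≤-Reasoning
  dist-evalWord {R = R} (≈-cong {u = u} {u′} {v} {v′} d e) = begin
    dist (evalWord φ (u ++ v)) (evalWord φ (u′ ++ v′))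
      ≡⟨ dist-cong (λ x → trans (evalWord-++ u v x) (cong (evalWord φ u) (sym (wordPerm-evalWord v x))))
                   (evalWord-++ u′ v′) ⟩
    dist (λ x → evalWord φ u (wordPerm v ⟨$⟩ʳ x)) (λ x → evalWord φ u′ (evalWord φ v′ x))
      ≤⟨ dist-∘ (wordPerm v) (evalWord φ u) (evalWord φ u′) (evalWord φ v′) ⟩
    dist (wordPerm v ⟨$⟩ʳ_) (evalWord φ v′) + dist (evalWord φ u) (evalWord φ u′)
      ≡⟨ cong (_+ dist (evalWord φ u) (evalWord φ u′)) (dist-cong (wordPerm-evalWord v) (λ _ → refl)) ⟩
    dist (evalWord φ v) (evalWord φ v′) + dist (evalWord φ u) (evalWord φ u′)
      ≤⟨ +-mono-≤ (dist-evalWord e) (dist-evalWord d) ⟩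
    relatorCount e * defect R + relatorCount d * defect R
      ≡⟨ +-comm (relatorCount e * defect R) _ ⟩
    relatorCount d * defect R + relatorCount e * defect R
      ≡⟨ *-distribʳ-+ (defect R) (relatorCount d) (relatorCount e) ⟨
    (relatorCount d + relatorCount e) * defect R ∎
    where open ≤-Reasoning
  dist-evalWord (≈-cancel s b) = ≤-reflexive (dist-≗ (cancels b))
    where
    cancels : ∀ b x → evalWord φ ((s , b) ∷ (s , not b) ∷ []) x ≡ x
    cancels true  x = inverseʳ (φ s)
    cancels false x = inverseˡ (φ s)
  dist-evalWord {R = R} (≈-rel r∈R) =
    ≤-trans (moved≤defect r∈R) (≤-reflexive (sym (+-identityʳ (defect R))))

-- Negligible sequences

-- a n / S n → 0, phrased without division.
Negligible : (S a : ℕ → ℕ) → Set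
Negligible S a = ∀ c → ∃[ n₀ ] ∀ n → n₀ ≤ n → c * a n ≤ S n

module _ {S : ℕ → ℕ} where

  negligible-≤ : {a b : ℕ → ℕ} → (∀ n → a n ≤ b n) → Negligible S b → Negligible S a
  negligible-≤ a≤b b≪S c with b≪S c
  ... | n₀ , small = n₀ , λ n n₀≤n → ≤-trans (*-monoʳ-≤ c (a≤b n)) (small n n₀≤n)

  negligible-weaken : {S′ a : ℕ → ℕ} → (∀ n → S n ≤ S′ n) → Negligible S a → Negligible S′ a
  negligible-weaken S≤S′ a≪S c with a≪S c
  ... | n₀ , small = n₀ , λ n n₀≤n → ≤-trans (small n n₀≤n) (S≤S′ n)

  negligible-+ : {a b : ℕ → ℕ} → Negligible S a → Negligible S b → Negligible S (λ n → a n + b n)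
  negligible-+ {a} {b} a≪S b≪S c with a≪S (2 * c) | b≪S (2 * c)
  ... | n₁ , a-small | n₂ , b-small = n₁ ⊔ n₂ , λ n n₀≤n → *-cancelˡ-≤ 2 (begin
    2 * (c * (a n + b n))      ≡⟨ distribute c (a n) (b n) ⟩
    2 * c * a n + 2 * c * b n  ≤⟨ +-mono-≤ (a-small n (m⊔n≤o⇒m≤o n₁ n₂ n₀≤n))
                                          (b-small n (m⊔n≤o⇒n≤o n₁ n₂ n₀≤n)) ⟩
    S n + S n                  ≡⟨ twice (S n) ⟩
    2 * S n                    ∎)
    where
    open ≤-Reasoning
    distribute : ∀ c a b → 2 * (c * (a + b)) ≡ 2 * c * a + 2 * c * b
    distribute = solve 3 (λ c a b → con 2 :* (c :* (a :+ b)) := con 2 :* c :* a :+ con 2 :* c :* b) refl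
    twice : ∀ s → s + s ≡ 2 * s
    twice = solve 1 (λ s → s :+ s := con 2 :* s) refl

  negligible-* : {a : ℕ → ℕ} (d : ℕ) → Negligible S a → Negligible S (λ n → d * a n)
  negligible-* {a} d a≪S c with a≪S (c * d)
  ... | n₀ , small = n₀ , λ n n₀≤n → ≤-trans (≤-reflexive (sym (*-assoc c d (a n)))) (small n n₀≤n)

  negligible-sum : {A : Set} {f : ℕ → A → ℕ} (xs : List A) →
                   (∀ {x} → x ∈ xs → Negligible S (λ n → f n x)) →
                   Negligible S (λ n → sum (map (f n) xs))
  negligible-sum []       _      c = 0 , λ n _ → ≤-trans (≤-reflexive (*-zeroʳ c)) z≤n
  negligible-sum (x ∷ xs) each≪S =
    negligible-+ (each≪S (here refl)) (negligible-sum xs (λ x∈xs → each≪S (there x∈xs)))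

-- Ratios of natural numbers

-- a / M, with a / 0 = 0 as in Pr.
ratio : ℕ → ℕ → ℚ
ratio a zero    = 0ℚ
ratio a (suc m) = ℤ.+ a ℚ./ suc m

Pr≡ratio : ∀ M (P : Fin M → Bool) → Pr M P ≡ ratio (count P) M
Pr≡ratio zero    P = refl
Pr≡ratio (suc M) P = refl

private
  +*+ : ∀ a b → ℤ.+ a ℤ.* ℤ.+ b ≡ ℤ.+ (a * b)
  +*+ a b = ℤ.+◃n≡+n (a * b)

  toℚᵘ-ratio : ∀ a m → toℚᵘ (ratio a (suc m)) ≃ mkℚᵘ (ℤ.+ a) m
  toℚᵘ-ratio a m = ℚ.toℚᵘ-fromℚᵘ (mkℚᵘ (ℤ.+ a) m)

ratio-≤-ratio : ∀ a m b n → a * suc n ≤ b * suc m → ratio a (suc m) ℚ.≤ ratio b (suc n)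
ratio-≤-ratio a m b n a*n≤b*m = ℚ.toℚᵘ-cancel-≤
  (ℚᵘ.≤-respˡ-≃ (ℚᵘ.≃-sym (toℚᵘ-ratio a m)) (ℚᵘ.≤-respʳ-≃ (ℚᵘ.≃-sym (toℚᵘ-ratio b n))
    (ℚᵘ.*≤* (subst₂ ℤ._≤_ (sym (+*+ a (suc n))) (sym (+*+ b (suc m))) (ℤ.+≤+ a*n≤b*m)))))

ratio-≤-ratio⁻¹ : ∀ a m b n → ratio a (suc m) ℚ.≤ ratio b (suc n) → a * suc n ≤ b * suc m
ratio-≤-ratio⁻¹ a m b n a/m≤b/n
  with ℚᵘ.≤-respˡ-≃ (toℚᵘ-ratio a m) (ℚᵘ.≤-respʳ-≃ (toℚᵘ-ratio b n) (ℚ.toℚᵘ-mono-≤ a/m≤b/n))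
... | ℚᵘ.*≤* a*n≤b*m = ℤ.drop‿+≤+ (subst₂ ℤ._≤_ (+*+ a (suc n)) (+*+ b (suc m)) a*n≤b*m)

ratio-mono : ∀ {a b} M → a ≤ b → ratio a M ℚ.≤ ratio b M
ratio-mono         zero    a≤b = ℚ.≤-refl
ratio-mono {a} {b} (suc m) a≤b = ratio-≤-ratio a m b m (*-monoˡ-≤ (suc m) a≤b)

0≤ratio : ∀ a M → 0ℚ ℚ.≤ ratio a M
0≤ratio a zero    = ℚ.≤-refl
0≤ratio a (suc m) = ratio-≤-ratio 0 0 a m z≤n

0<1/suc : ∀ j → 0ℚ ℚ.< ratio 1 (suc j)
0<1/suc j = ℚ.toℚᵘ-cancel-< (ℚᵘ.<-respʳ-≃ (ℚᵘ.≃-sym (toℚᵘ-ratio 1 j))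
  (ℚᵘ.*<* (subst₂ ℤ._<_ (sym (+*+ 0 (suc j))) (sym (+*+ 1 1)) (ℤ.+<+ (s≤s z≤n)))))

archimedean : ∀ δ → 0ℚ ℚ.< δ → ∃[ j ] ratio 1 (suc j) ℚ.≤ δ
archimedean (ℚ.mkℚ (ℤ.+ suc n) d _) _ = d , ℚ.toℚᵘ-cancel-≤ (ℚᵘ.≤-respˡ-≃ (ℚᵘ.≃-sym (toℚᵘ-ratio 1 d))
  (ℚᵘ.*≤* (subst₂ ℤ._≤_ (sym (+*+ 1 (suc d))) (sym (+*+ (suc n) (suc d)))
    (ℤ.+≤+ (*-monoˡ-≤ (suc d) {1} {suc n} (s≤s z≤n))))))
archimedean (ℚ.mkℚ (ℤ.+ zero)   _ _) (ℚ.*<* (ℤ.+<+ ()))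
archimedean (ℚ.mkℚ ℤ.-[1+ _ ] _ _) (ℚ.*<* ())

-δ≤ratio : ∀ δ a M → 0ℚ ℚ.< δ → 0ℚ ℚ.- δ ℚ.≤ ratio a M
-δ≤ratio δ a M 0<δ = ℚ.≤-trans (ℚ.≤-reflexive (ℚ.+-identityˡ (ℚ.- δ)))
  (ℚ.≤-trans (ℚ.neg-antimono-≤ (ℚ.<⇒≤ 0<δ)) (0≤ratio a M))

ratio≤1/suc : ∀ a M j → suc j * a ≤ M → ratio a M ℚ.≤ ratio 1 (suc j)
ratio≤1/suc a zero    j _     = 0≤ratio 1 (suc j)
ratio≤1/suc a (suc m) j j*a≤M =
  ratio-≤-ratio a m 1 j (subst₂ _≤_ (*-comm (suc j) a) (sym (+-identityʳ (suc m))) j*a≤M)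

ratio≤1/suc⁻¹ : ∀ a M j → 1 ≤ M → ratio a M ℚ.≤ ratio 1 (suc j) → suc j * a ≤ M
ratio≤1/suc⁻¹ a (suc m) j _ a/M≤1/j =
  subst₂ _≤_ (*-comm a (suc j)) (+-identityʳ (suc m)) (ratio-≤-ratio⁻¹ a m 1 j a/M≤1/j)

private
  ≤+⇒-≤ : ∀ p q r → p ℚ.≤ q ℚ.+ r → p ℚ.- r ℚ.≤ q
  ≤+⇒-≤ p q r p≤q+r = ℚ.≤-trans (ℚ.+-monoˡ-≤ (ℚ.- r) p≤q+r) (ℚ.≤-reflexive
    (trans (ℚ.+-assoc q r (ℚ.- r)) (trans (cong (q ℚ.+_) (ℚ.+-inverseʳ r)) (ℚ.+-identityʳ q))))

  -≤⇒≤+ : ∀ p q r → p ℚ.- r ℚ.≤ q → p ℚ.≤ q ℚ.+ r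
  -≤⇒≤+ p q r p-r≤q = ℚ.≤-trans (ℚ.≤-reflexive
    (sym (trans (ℚ.+-assoc p (ℚ.- r) r) (trans (cong (p ℚ.+_) (ℚ.+-inverseˡ r)) (ℚ.+-identityʳ p)))))
    (ℚ.+-monoˡ-≤ r p-r≤q)

  toℚᵘ-ratio+1/suc : ∀ a m j →
    toℚᵘ (ratio a (suc m) ℚ.+ ratio 1 (suc j)) ≃ mkℚᵘ (ℤ.+ a) m ℚᵘ.+ mkℚᵘ (ℤ.+ 1) j
  toℚᵘ-ratio+1/suc a m j = ℚᵘ.≃-trans (ℚ.toℚᵘ-homo-+ (ratio a (suc m)) (ratio 1 (suc j)))
    (ℚᵘ.+-cong (toℚᵘ-ratio a m) (toℚᵘ-ratio 1 j))

  numerator : ∀ a m j → ℚᵘ.↥ (mkℚᵘ (ℤ.+ a) m ℚᵘ.+ mkℚᵘ (ℤ.+ 1) j) ≡ ℤ.+ (a * suc j + 1 * suc m)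
  numerator a m j = trans (cong₂ ℤ._+_ (+*+ a (suc j)) (+*+ 1 (suc m))) (sym (ℤ.pos-+ (a * suc j) _))

  1≤ratio+1/suc : ∀ a m j → suc m * suc j ≤ a * suc j + 1 * suc m →
                  1ℚ ℚ.≤ ratio a (suc m) ℚ.+ ratio 1 (suc j)
  1≤ratio+1/suc a m j ineq = ℚ.toℚᵘ-cancel-≤ (ℚᵘ.≤-respʳ-≃ (ℚᵘ.≃-sym (toℚᵘ-ratio+1/suc a m j))
    (ℚᵘ.*≤* (subst₂ ℤ._≤_ (sym (ℤ.*-identityˡ _)) (sym (trans (ℤ.*-identityʳ _) (numerator a m j)))
      (ℤ.+≤+ ineq))))

  1≤ratio+1/suc⁻¹ : ∀ a m j → 1ℚ ℚ.≤ ratio a (suc m) ℚ.+ ratio 1 (suc j) →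
                    suc m * suc j ≤ a * suc j + 1 * suc m
  1≤ratio+1/suc⁻¹ a m j 1≤sum with ℚᵘ.≤-respʳ-≃ (toℚᵘ-ratio+1/suc a m j) (ℚ.toℚᵘ-mono-≤ 1≤sum)
  ... | ℚᵘ.*≤* ineq = ℤ.drop‿+≤+
    (subst₂ ℤ._≤_ (ℤ.*-identityˡ _) (trans (ℤ.*-identityʳ _) (numerator a m j)) ineq)

  split : ∀ a f m j → a + f ≡ suc m → suc m * suc j ≡ a * suc j + f * suc j
  split a f m j a+f≡M = trans (cong (_* suc j) (sym a+f≡M)) (*-distribʳ-+ (suc j) a f)

1-δ≤ratio : ∀ a f M j δ → 1 ≤ M → a + f ≡ M → suc j * f ≤ M → ratio 1 (suc j) ℚ.≤ δ →
            1ℚ ℚ.- δ ℚ.≤ ratio a M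
1-δ≤ratio a f (suc m) j δ _ a+f≡M j*f≤M 1/j≤δ = ≤+⇒-≤ 1ℚ (ratio a (suc m)) δ
  (ℚ.≤-trans (1≤ratio+1/suc a m j (begin
      suc m * suc j          ≡⟨ split a f m j a+f≡M ⟩
      a * suc j + f * suc j  ≤⟨ +-monoʳ-≤ (a * suc j)
                                  (subst₂ _≤_ (*-comm (suc j) f) (sym (+-identityʳ (suc m))) j*f≤M) ⟩
      a * suc j + 1 * suc m  ∎))
    (ℚ.+-monoʳ-≤ (ratio a (suc m)) 1/j≤δ))
  where open ≤-Reasoning

1-1/suc≤ratio⁻¹ : ∀ a f M j → 1 ≤ M → a + f ≡ M → 1ℚ ℚ.- ratio 1 (suc j) ℚ.≤ ratio a M →
                  suc j * f ≤ M
1-1/suc≤ratio⁻¹ a f (suc m) j _ a+f≡M 1-1/j≤a/M =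
  subst₂ _≤_ (*-comm f (suc j)) (+-identityʳ (suc m))
    (+-cancelˡ-≤ (a * suc j) _ _
      (subst (_≤ a * suc j + 1 * suc m) (split a f m j a+f≡M)
        (1≤ratio+1/suc⁻¹ a m j (-≤⇒≤+ 1ℚ (ratio a (suc m)) (ratio 1 (suc j)) 1-1/j≤a/M))))

-- Sofic approximations in terms of point counts

record IsCountingSoficApprox {k : ℕ} (R : List (Word k)) (N : ℕ → ℕ)
         (φ : (n : ℕ) → Fin k → Permutation′ (N n)) : Set where
  field
    nonempty   : ∀ n → 1 ≤ N n
    relators   : Negligible N (λ n → defect (φ n) R)
    separating : ∀ w → ¬ InNormalClosure R w → Negligible N (λ n → fixed (evalWord (φ n) w))

module _ {R : List (Word k)} {N : ℕ → ℕ} {φ : (n : ℕ) → Fin k → Permutation′ (N n)} where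

  private
    moved+fixed≡N : (f : Fin M → Fin M) → moved f + fixed f ≡ M
    moved+fixed≡N f = trans (+-comm (moved f) (fixed f)) (fixed+moved≡N f)

  fromIsSoficApprox : IsSoficApprox R N φ → IsCountingSoficApprox R N φ
  fromIsSoficApprox approx = record
    { nonempty   = nonempty
    ; relators   = negligible-sum R relatorNegligible
    ; separating = separatingNegligible
    }
    where
    open IsSoficApprox approx

    relatorNegligible : ∀ {r} → r ∈ R → Negligible N (λ n → moved (evalWord (φ n) r))
    relatorNegligible {r} r∈R c with almost
    ... | ε , ε-bound , ε→0 with ε→0 (ratio 1 (suc c)) (0<1/suc c)
    ...   | n₀ , ε-small = n₀ , λ n n₀≤n → ≤-trans (*-monoˡ-≤ _ (n≤1+n c))
      (ratio≤1/suc⁻¹ _ (N n) c (nonempty n)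
        (ℚ.≤-trans (ℚ.≤-reflexive (sym (Pr≡ratio (N n) _)))
          (ℚ.≤-trans (ε-bound n r r∈R) (proj₁ (ε-small n n₀≤n)))))

    separatingNegligible : ∀ w → ¬ InNormalClosure R w → Negligible N (λ n → fixed (evalWord (φ n) w))
    separatingNegligible w w∉⟨⟨R⟩⟩ c with separating w w∉⟨⟨R⟩⟩ (ratio 1 (suc c)) (0<1/suc c)
    ... | n₀ , far = n₀ , λ n n₀≤n → ≤-trans (*-monoˡ-≤ _ (n≤1+n c))
      (1-1/suc≤ratio⁻¹ _ _ (N n) c (nonempty n) (moved+fixed≡N (evalWord (φ n) w))
        (ℚ.≤-trans (far n n₀≤n) (ℚ.≤-reflexive (Pr≡ratio (N n) _))))

  toIsSoficApprox : IsCountingSoficApprox R N φ → IsSoficApprox R N φ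
  toIsSoficApprox approx = record
    { nonempty   = nonempty
    ; almost     = ε , ε-bound , ε→0
    ; separating = far
    }
    where
    open IsCountingSoficApprox approx

    ε : ℕ → ℚ
    ε n = ratio (defect (φ n) R) (N n)

    ε-bound : ∀ n → DefAtMost R (φ n) (ε n)
    ε-bound n r r∈R =
      ℚ.≤-trans (ℚ.≤-reflexive (Pr≡ratio (N n) _)) (ratio-mono (N n) (moved≤defect (φ n) r∈R))

    ε→0 : ∀ δ → 0ℚ ℚ.< δ → ∃[ n₀ ] ∀ n → n₀ ≤ n → ε n ℚ.≤ δ × 0ℚ ℚ.- δ ℚ.≤ ε n
    ε→0 δ 0<δ with archimedean δ 0<δ
    ... | j , 1/j≤δ with relators (suc j)
    ...   | n₀ , small = n₀ , λ n n₀≤n →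
      ℚ.≤-trans (ratio≤1/suc _ (N n) j (small n n₀≤n)) 1/j≤δ , -δ≤ratio δ _ (N n) 0<δ

    far : ∀ w → ¬ InNormalClosure R w → ∀ δ → 0ℚ ℚ.< δ →
          ∃[ n₀ ] ∀ n → n₀ ≤ n → 1ℚ ℚ.- δ ℚ.≤ movedFrac (evalWord (φ n) w)
    far w w∉⟨⟨R⟩⟩ δ 0<δ with archimedean δ 0<δ
    ... | j , 1/j≤δ with separating w w∉⟨⟨R⟩⟩ (suc j)
    ...   | n₀ , small = n₀ , λ n n₀≤n → ℚ.≤-trans
      (1-δ≤ratio _ _ (N n) j δ (nonempty n) (moved+fixed≡N (evalWord (φ n) w)) (small n n₀≤n) 1/j≤δ)
      (ℚ.≤-reflexive (sym (Pr≡ratio (N n) _)))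

-- First-return maps

IsFirstHit : (ℕ → Bool) → ℕ → Set
IsFirstHit P k = 1 ≤ k × P k ≡ true × (∀ j → 1 ≤ j → j < k → P j ≡ false)

firstHit-unique : ∀ {P k k′} → IsFirstHit P k → IsFirstHit P k′ → k ≡ k′
firstHit-unique {k = k} {k′} (1≤k , Pk , before) (1≤k′ , Pk′ , before′) with <-cmp k k′
... | tri< k<k′ _ _ = contradiction (trans (sym Pk) (before′ k 1≤k k<k′)) λ ()
... | tri≈ _ k≡k′ _ = k≡k′
... | tri> _ _ k′<k = contradiction (trans (sym Pk′) (before k′ 1≤k′ k′<k)) λ ()

isFirstHit-cong : ∀ {P Q k} → (∀ j → P j ≡ Q j) → IsFirstHit P k → IsFirstHit Q k
isFirstHit-cong P≗Q (1≤k , Pk , before) =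
  1≤k , trans (sym (P≗Q _)) Pk , λ j 1≤j j<k → trans (sym (P≗Q j)) (before j 1≤j j<k)

firstFrom : (ℕ → Bool) → ℕ → ℕ → ℕ
firstFrom P i zero    = i
firstFrom P i (suc f) = if P i then i else firstFrom P (suc i) f

firstFrom-miss : ∀ P i f j → i ≤ j → j < firstFrom P i f → P j ≡ false
firstFrom-miss P i zero    j i≤j j<i = contradiction i≤j (<⇒≱ j<i)
firstFrom-miss P i (suc f) j i≤j j<first with P i in Pi
... | true  = contradiction i≤j (<⇒≱ j<first)
... | false with <-cmp i j
...   | tri< i<j _ _ = firstFrom-miss P (suc i) f j i<j j<first
...   | tri≈ _ refl _ = Pi
...   | tri> _ _ j<i = contradiction i≤j (<⇒≱ j<i)

firstFrom-hit : ∀ P i f p → i ≤ p → p < i + f → P p ≡ true →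
                i ≤ firstFrom P i f × firstFrom P i f ≤ p × P (firstFrom P i f) ≡ true
firstFrom-hit P i zero    p i≤p p<i+0 Pp rewrite +-identityʳ i = contradiction i≤p (<⇒≱ p<i+0)
firstFrom-hit P i (suc f) p i≤p p<i+f Pp with P i in Pi
... | true  = ≤-refl , i≤p , Pi
... | false = map₁ <⇒≤
  (firstFrom-hit P (suc i) f p (≤∧≢⇒< i≤p i≢p) (≤-trans p<i+f (≤-reflexive (+-suc i f))) Pp)
  where
  i≢p : i ≢ p
  i≢p refl = contradiction (trans (sym Pi) Pp) λ ()

firstFrom-isFirstHit : ∀ P L p → 1 ≤ p → p ≤ L → P p ≡ true →
                       IsFirstHit P (firstFrom P 1 L) × firstFrom P 1 L ≤ L
firstFrom-isFirstHit P L p 1≤p p≤L Pp with firstFrom-hit P 1 L p 1≤p (s≤s p≤L) Pp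
... | 1≤first , first≤p , hit =
  (1≤first , hit , λ j 1≤j → firstFrom-miss P 1 L j 1≤j) , ≤-trans first≤p p≤L

-- A permutation h is made to commute with an involution F by following each pair (y , F y)
-- under h × h until it returns to the graph of F.

module FirstReturn {M : ℕ} (F : Fin M → Fin M) (F-involutive : ∀ y → F (F y) ≡ y) where

  open Endo (Fin M) using (_^_; ^-homo)

  does-≟-F : (a b : Fin M) → does (a ≟ F b) ≡ does (b ≟ F a)
  does-≟-F a b with a ≟ F b | b ≟ F a
  ... | yes _    | yes _    = refl
  ... | yes a≡Fb | no b≢Fa  = contradiction (trans (sym (F-involutive b)) (cong F (sym a≡Fb))) b≢Fa
  ... | no a≢Fb  | yes b≡Fa = contradiction (trans (sym (F-involutive a)) (cong F (sym b≡Fa))) a≢Fb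
  ... | no _     | no _     = refl

  commutesAt : (Fin M → Fin M) → Fin M → ℕ → Bool
  commutesAt h y k = does ((h ^ k) (F y) ≟ F ((h ^ k) y))

  returnTime : (Fin M → Fin M) → Fin M → ℕ
  returnTime h y = firstFrom (commutesAt h y) 1 (M * M)

  firstReturn : (Fin M → Fin M) → Fin M → Fin M
  firstReturn h y = (h ^ returnTime h y) y

  module _ (π : Permutation′ M) where

    private
      h h⁻¹ : Fin M → Fin M
      h = π ⟨$⟩ʳ_
      h⁻¹ = π ⟨$⟩ˡ_

    ^-injective : ∀ k {a b} → (h ^ k) a ≡ (h ^ k) b → a ≡ b
    ^-injective zero    eq = eq
    ^-injective (suc k) eq = ^-injective k (trans (sym (inverseˡ π)) (trans (cong h⁻¹ eq) (inverseˡ π)))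

    ⁻¹^-^ : ∀ j k y → j ≤ k → (h⁻¹ ^ j) ((h ^ k) y) ≡ (h ^ (k ∸ j)) y
    ⁻¹^-^ zero    k       y _         = refl
    ⁻¹^-^ (suc j) (suc k) y (s≤s j≤k) = begin
      h⁻¹ ((h⁻¹ ^ j) ((h ^ suc k) y))  ≡⟨ cong h⁻¹ (⁻¹^-^ j (suc k) y (m≤n⇒m≤1+n j≤k)) ⟩
      h⁻¹ ((h ^ (suc k ∸ j)) y)        ≡⟨ cong (λ m → h⁻¹ ((h ^ m) y)) (+-∸-assoc 1 j≤k) ⟩
      h⁻¹ (h ((h ^ (k ∸ j)) y))        ≡⟨ inverseˡ π ⟩
      (h ^ (k ∸ j)) y                  ∎
      where open ≡-Reasoning

    -- Pigeonhole on the M * M + 1 pairs ((h ^ i) a , (h ^ i) b) for i ≤ M * M.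
    commonPeriod : ∀ a b → ∃[ p ] 1 ≤ p × p ≤ M * M × (h ^ p) a ≡ a × (h ^ p) b ≡ b
    commonPeriod a b with Fin.pigeonhole (n<1+n (M * M)) (λ i → combine ((h ^ toℕ i) a) ((h ^ toℕ i) b))
    ... | i , j , i<j , same with Fin.combine-injective _ _ _ _ same
    ...   | aᵢ≡aⱼ , bᵢ≡bⱼ =
      toℕ j ∸ toℕ i , m<n⇒0<n∸m i<j , ≤-trans (m∸n≤m (toℕ j) (toℕ i)) (≤-pred (Fin.toℕ<n j)) ,
      returns aᵢ≡aⱼ , returns bᵢ≡bⱼ
      where
      returns : ∀ {x} → (h ^ toℕ i) x ≡ (h ^ toℕ j) x → (h ^ (toℕ j ∸ toℕ i)) x ≡ x
      returns {x} eq = sym (^-injective (toℕ i) (trans eq (trans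
        (cong (λ m → (h ^ m) x) (sym (m+[n∸m]≡n (<⇒≤ i<j))))
        (cong-app (^-homo h (toℕ i) (toℕ j ∸ toℕ i)) x))))

    returnTime-isFirstHit : ∀ y → IsFirstHit (commutesAt h y) (returnTime h y)
    returnTime-isFirstHit y with commonPeriod y (F y)
    ... | p , 1≤p , p≤L , yₚ≡y , Fyₚ≡Fy = proj₁ (firstFrom-isFirstHit (commutesAt h y) (M * M) p 1≤p p≤L
      (dec-true (_ ≟ _) (trans Fyₚ≡Fy (cong F (sym yₚ≡y)))))

    returnTime-unique : ∀ {y k} → IsFirstHit (commutesAt h y) k → returnTime h y ≡ k
    returnTime-unique hit = firstHit-unique (returnTime-isFirstHit _) hit

    firstReturn-agrees : ∀ y → h (F y) ≡ F (h y) → firstReturn h y ≡ h y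
    firstReturn-agrees y commutes = cong (λ k → (h ^ k) y)
      (returnTime-unique (s≤s z≤n , dec-true (_ ≟ _) commutes , λ j 1≤j j<1 → contradiction 1≤j (<⇒≱ j<1)))

    firstReturn-comm : ∀ y → firstReturn h (F y) ≡ F (firstReturn h y)
    firstReturn-comm y = begin
      (h ^ returnTime h (F y)) (F y)
        ≡⟨ cong (λ k → (h ^ k) (F y)) (returnTime-unique (isFirstHit-cong symmetric hit)) ⟩
      (h ^ returnTime h y) (F y)      ≡⟨ does-true⇒≡ (proj₁ (proj₂ hit)) ⟩
      F ((h ^ returnTime h y) y)      ∎
      where
      open ≡-Reasoning
      hit : IsFirstHit (commutesAt h y) (returnTime h y)
      hit = returnTime-isFirstHit y
      symmetric : ∀ k → commutesAt h y k ≡ commutesAt h (F y) k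
      symmetric k = trans (does-≟-F ((h ^ k) (F y)) ((h ^ k) y))
                          (cong (λ x → does ((h ^ k) x ≟ F ((h ^ k) (F y)))) (sym (F-involutive y)))

  firstReturn-inverse : (π : Permutation′ M) → ∀ y → firstReturn (π ⟨$⟩ˡ_) (firstReturn (π ⟨$⟩ʳ_) y) ≡ y
  firstReturn-inverse π y = begin
    (h⁻¹ ^ returnTime h⁻¹ z) z  ≡⟨ cong (λ j → (h⁻¹ ^ j) z) (returnTime-unique (flip π) hit⁻¹) ⟩
    (h⁻¹ ^ r) ((h ^ r) y)       ≡⟨ ⁻¹^-^ π r r y ≤-refl ⟩
    (h ^ (r ∸ r)) y             ≡⟨ cong (λ j → (h ^ j) y) (n∸n≡0 r) ⟩
    y                           ∎
    where
    open ≡-Reasoning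
    h h⁻¹ : Fin M → Fin M
    h = π ⟨$⟩ʳ_
    h⁻¹ = π ⟨$⟩ˡ_
    r : ℕ
    r = returnTime h y
    z : Fin M
    z = (h ^ r) y
    hit : IsFirstHit (commutesAt h y) r
    hit = returnTime-isFirstHit π y
    -- Running backwards from z retraces the orbit of (y , F y), which meets the graph of F first at y.
    backwards : ∀ j → j ≤ r → commutesAt h⁻¹ z j ≡ commutesAt h y (r ∸ j)
    backwards j j≤r = cong₂ (λ a b → does (a ≟ F b))
      (trans (cong (h⁻¹ ^ j) (sym (does-true⇒≡ (proj₁ (proj₂ hit))))) (⁻¹^-^ π j r (F y) j≤r))
      (⁻¹^-^ π j r y j≤r)
    hit⁻¹ : IsFirstHit (commutesAt h⁻¹ z) r
    hit⁻¹ = proj₁ hit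
          , trans (backwards r ≤-refl) (trans (cong (commutesAt h y) (n∸n≡0 r)) (dec-true (F y ≟ F y) refl))
          , λ j 1≤j j<r → trans (backwards j (<⇒≤ j<r))
              (proj₂ (proj₂ hit) (r ∸ j) (m<n⇒0<n∸m j<r) (∸-monoʳ-< 1≤j (<⇒≤ j<r)))

  firstReturnPerm : Permutation′ M → Permutation′ M
  firstReturnPerm π = permutation (firstReturn (π ⟨$⟩ʳ_)) (firstReturn (π ⟨$⟩ˡ_))
    (firstReturn-inverse (flip π)) (firstReturn-inverse π)

  dist-firstReturn : (π : Permutation′ M) →
    dist (firstReturn (π ⟨$⟩ʳ_)) (π ⟨$⟩ʳ_) ≤ dist (λ y → π ⟨$⟩ʳ F y) (λ y → F (π ⟨$⟩ʳ y))
  dist-firstReturn π = count-mono step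
    where
    step : ∀ y → firstReturn (π ⟨$⟩ʳ_) y ≢ᵇ π ⟨$⟩ʳ y ≡ true → (π ⟨$⟩ʳ F y) ≢ᵇ F (π ⟨$⟩ʳ y) ≡ true
    step y differs with (π ⟨$⟩ʳ F y) ≟ F (π ⟨$⟩ʳ y)
    ... | yes commutes = contradiction (firstReturn-agrees π y commutes) (≢ᵇ-true⇒≢ differs)
    ... | no  _        = refl

-- Two copies of Fin N, realised as Fin (N + N)

module TwoCopies (N : ℕ) where

  lift : (Fin N ⊎ Fin N → Fin N ⊎ Fin N) → Fin (N + N) → Fin (N + N)
  lift h y = join N N (h (splitAt N y))

  lift-cong : ∀ {g h} → (∀ z → g z ≡ h z) → ∀ y → lift g y ≡ lift h y
  lift-cong g≗h y = cong (join N N) (g≗h (splitAt N y))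

  lift-∘ : ∀ g h y → lift g (lift h y) ≡ lift (g ∘ h) y
  lift-∘ g h y = cong (join N N ∘ g) (Fin.splitAt-join N N (h (splitAt N y)))

  lift-id : ∀ {h} → (∀ z → h z ≡ z) → ∀ y → lift h y ≡ y
  lift-id h≗id y = trans (lift-cong h≗id y) (Fin.join-splitAt N N y)

  lift-↑ˡ : ∀ h x → lift h (x ↑ˡ N) ≡ join N N (h (inj₁ x))
  lift-↑ˡ h x = cong (join N N ∘ h) (Fin.splitAt-↑ˡ N x N)

  lift-↑ʳ : ∀ h x → lift h (N ↑ʳ x) ≡ join N N (h (inj₂ x))
  lift-↑ʳ h x = cong (join N N ∘ h) (Fin.splitAt-↑ʳ N N x)

  neg : Fin (N + N) → Fin (N + N)
  neg = negId {N}

  neg≡lift-swap : ∀ y → neg y ≡ lift swap y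
  neg≡lift-swap y with splitAt N y
  ... | inj₁ _ = refl
  ... | inj₂ _ = refl

  neg-involutive : ∀ y → neg (neg y) ≡ y
  neg-involutive y = begin
    neg (neg y)              ≡⟨ neg≡lift-swap (neg y) ⟩
    lift swap (neg y)        ≡⟨ cong (lift swap) (neg≡lift-swap y) ⟩
    lift swap (lift swap y)  ≡⟨ lift-∘ swap swap y ⟩
    lift (swap ∘ swap) y     ≡⟨ lift-id swap-involutive y ⟩
    y                        ∎
    where open ≡-Reasoning

  negPerm : Permutation′ (N + N)
  negPerm = permutation neg neg neg-involutive neg-involutive

  double : (Fin N → Fin N) → Fin (N + N) → Fin (N + N)
  double g = lift (map⊎ g g)

  double-↑ˡ : ∀ g x → double g (x ↑ˡ N) ≡ g x ↑ˡ N
  double-↑ˡ g = lift-↑ˡ (map⊎ g g)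

  double-↑ʳ : ∀ g x → double g (N ↑ʳ x) ≡ N ↑ʳ g x
  double-↑ʳ g = lift-↑ʳ (map⊎ g g)

  double-∘ : ∀ f g y → double f (double g y) ≡ double (f ∘ g) y
  double-∘ f g y = trans (lift-∘ (map⊎ f f) (map⊎ g g) y)
    (lift-cong {g = map⊎ f f ∘ map⊎ g g} {h = map⊎ (f ∘ g) (f ∘ g)}
               (λ { (inj₁ _) → refl ; (inj₂ _) → refl }) y)

  double-id : ∀ {g} → (∀ x → g x ≡ x) → ∀ y → double g y ≡ y
  double-id {g} g≗id =
    lift-id {h = map⊎ g g} (λ { (inj₁ x) → cong inj₁ (g≗id x) ; (inj₂ x) → cong inj₂ (g≗id x) })

  doublePerm : Permutation′ N → Permutation′ (N + N)
  doublePerm π = permutation (double (π ⟨$⟩ʳ_)) (double (π ⟨$⟩ˡ_))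
    (λ y → trans (double-∘ _ _ y) (double-id (λ _ → inverseʳ π) y))
    (λ y → trans (double-∘ _ _ y) (double-id (λ _ → inverseˡ π) y))

  countFix-double : (c : Bool → Bool) (g : Fin N → Fin N) →
                    countFix c (double g) ≡ countFix c g + countFix c g
  countFix-double c g = trans (count-↑ {N} {N} (λ y → c (does (double g y ≟ y)))) (cong₂ _+_
    (count-cong (λ x → cong c (trans (cong (λ z → does (z ≟ x ↑ˡ N)) (double-↑ˡ g x))
                                     (does-injective (_↑ˡ N) (Fin.↑ˡ-injective N _ _) (g x) x))))
    (count-cong (λ x → cong c (trans (cong (λ z → does (z ≟ N ↑ʳ x)) (double-↑ʳ g x))
                                     (does-injective (N ↑ʳ_) (Fin.↑ʳ-injective N _ _) (g x) x)))))

-- For an involution u, pair exchanges inj₂ x with inj₁ (u x) whenever x < u x. Then pair ∘ swap ∘ pair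
-- maps inj₁ x ↦ inj₁ (u x) and inj₂ x ↦ inj₂ (u x) when u x ≢ x, and swaps the copies otherwise.

module Pairing {N : ℕ} (u : Fin N → Fin N) (u-involutive : ∀ x → u (u x) ≡ x) where

  open TwoCopies N

  pair : Fin N ⊎ Fin N → Fin N ⊎ Fin N
  pair (inj₁ x) with u x Fin.<? x
  ... | yes _ = inj₂ (u x)
  ... | no  _ = inj₁ x
  pair (inj₂ x) with x Fin.<? u x
  ... | yes _ = inj₁ (u x)
  ... | no  _ = inj₂ x

  private
    pair₁-< : ∀ {x} → u x Fin.< x → pair (inj₁ x) ≡ inj₂ (u x)
    pair₁-< {x} ux<x with u x Fin.<? x
    ... | yes _    = refl
    ... | no  ux≮x = contradiction ux<x ux≮x

    pair₁-≮ : ∀ {x} → ¬ u x Fin.< x → pair (inj₁ x) ≡ inj₁ x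
    pair₁-≮ {x} ux≮x with u x Fin.<? x
    ... | yes ux<x = contradiction ux<x ux≮x
    ... | no  _    = refl

    pair₂-< : ∀ {x} → x Fin.< u x → pair (inj₂ x) ≡ inj₁ (u x)
    pair₂-< {x} x<ux with x Fin.<? u x
    ... | yes _    = refl
    ... | no  x≮ux = contradiction x<ux x≮ux

    pair₂-≮ : ∀ {x} → ¬ x Fin.< u x → pair (inj₂ x) ≡ inj₂ x
    pair₂-≮ {x} x≮ux with x Fin.<? u x
    ... | yes x<ux = contradiction x<ux x≮ux
    ... | no  _    = refl

    <-at-u : ∀ {x} → x Fin.< u x → u (u x) Fin.< u x
    <-at-u {x} = subst (Fin._< u x) (sym (u-involutive x))

    >-at-u : ∀ {x} → u x Fin.< x → u x Fin.< u (u x)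
    >-at-u {x} = subst (u x Fin.<_) (sym (u-involutive x))

  pair-involutive : ∀ z → pair (pair z) ≡ z
  pair-involutive (inj₁ x) with u x Fin.<? x
  ... | yes ux<x = trans (pair₂-< (>-at-u ux<x)) (cong inj₁ (u-involutive x))
  ... | no  ux≮x = pair₁-≮ ux≮x
  pair-involutive (inj₂ x) with x Fin.<? u x
  ... | yes x<ux = trans (pair₁-< (<-at-u x<ux)) (cong inj₂ (u-involutive x))
  ... | no  x≮ux = pair₂-≮ x≮ux

  pair-swap-pair₁ : ∀ x → u x ≢ x → pair (swap (pair (inj₁ x))) ≡ inj₁ (u x)
  pair-swap-pair₁ x ux≢x with Fin.<-cmp (u x) x
  ... | tri< ux<x _ _ rewrite pair₁-< ux<x = pair₁-≮ (Fin.<-asym (>-at-u ux<x))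
  ... | tri≈ _ ux≡x _ = contradiction ux≡x ux≢x
  ... | tri> _ _ x<ux rewrite pair₁-≮ (Fin.<-asym x<ux) = pair₂-< x<ux

  pair-swap-pair₂ : ∀ x → u x ≢ x → pair (swap (pair (inj₂ x))) ≡ inj₂ (u x)
  pair-swap-pair₂ x ux≢x with Fin.<-cmp (u x) x
  ... | tri< ux<x _ _ rewrite pair₂-≮ (Fin.<-asym ux<x) = pair₁-< ux<x
  ... | tri≈ _ ux≡x _ = contradiction ux≡x ux≢x
  ... | tri> _ _ x<ux rewrite pair₂-< x<ux = pair₂-≮ (Fin.<-asym (<-at-u x<ux))

  pairing : Fin (N + N) → Fin (N + N)
  pairing = lift pair

  pairing-involutive : ∀ y → pairing (pairing y) ≡ y
  pairing-involutive y = trans (lift-∘ pair pair y) (lift-id pair-involutive y)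

  pairingPerm : Permutation′ (N + N)
  pairingPerm = permutation pairing pairing pairing-involutive pairing-involutive

  freeDouble : Fin (N + N) → Fin (N + N)
  freeDouble = lift (pair ∘ swap ∘ pair)

  freeDouble-↑ˡ : ∀ x → u x ≢ x → freeDouble (x ↑ˡ N) ≡ u x ↑ˡ N
  freeDouble-↑ˡ x ux≢x =
    trans (lift-↑ˡ (pair ∘ swap ∘ pair) x) (cong (join N N) (pair-swap-pair₁ x ux≢x))

  freeDouble-↑ʳ : ∀ x → u x ≢ x → freeDouble (N ↑ʳ x) ≡ N ↑ʳ u x
  freeDouble-↑ʳ x ux≢x =
    trans (lift-↑ʳ (pair ∘ swap ∘ pair) x) (cong (join N N) (pair-swap-pair₂ x ux≢x))

  pairing-neg : ∀ y → pairing (neg y) ≡ freeDouble (pairing y)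
  pairing-neg y = begin
    pairing (neg y)                     ≡⟨ cong pairing (neg≡lift-swap y) ⟩
    lift pair (lift swap y)             ≡⟨ lift-∘ pair swap y ⟩
    lift (pair ∘ swap) y                ≡⟨ lift-cong (λ z → cong (pair ∘ swap) (pair-involutive z)) y ⟨
    lift (pair ∘ swap ∘ pair ∘ pair) y  ≡⟨ lift-∘ (pair ∘ swap ∘ pair) pair y ⟨
    freeDouble (pairing y)              ∎
    where open ≡-Reasoning

  neg-pairing : ∀ y → neg (pairing y) ≡ pairing (freeDouble y)
  neg-pairing y = begin
    neg (pairing y)                            ≡⟨ pairing-involutive _ ⟨
    pairing (pairing (neg (pairing y)))        ≡⟨ cong pairing (pairing-neg (pairing y)) ⟩
    pairing (freeDouble (pairing (pairing y))) ≡⟨ cong (pairing ∘ freeDouble) (pairing-involutive y) ⟩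
    pairing (freeDouble y)                     ∎
    where open ≡-Reasoning

  twistedDouble : Permutation′ N → Permutation′ (N + N)
  twistedDouble π = pairingPerm ∘ₚ doublePerm π ∘ₚ pairingPerm

  module _ {k : ℕ} (φ : Fin k → Permutation′ N) where

    evalWord-twistedDouble : ∀ w y → evalWord (twistedDouble ∘ φ) w y ≡
                                     pairing (double (evalWord φ w) (pairing y))
    evalWord-twistedDouble [] y =
      sym (trans (cong pairing (double-id {g = id} (λ _ → refl) (pairing y))) (pairing-involutive y))
    evalWord-twistedDouble ((s , b) ∷ w) y = begin
      actLetter (twistedDouble ∘ φ) (s , b) (evalWord (twistedDouble ∘ φ) w y)
        ≡⟨ cong (actLetter (twistedDouble ∘ φ) (s , b)) (evalWord-twistedDouble w y) ⟩
      actLetter (twistedDouble ∘ φ) (s , b) (pairing (double (evalWord φ w) (pairing y)))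
        ≡⟨ actLetter-twistedDouble b _ ⟩
      pairing (double (actLetter φ (s , b)) (pairing (pairing (double (evalWord φ w) (pairing y)))))
        ≡⟨ cong (pairing ∘ double (actLetter φ (s , b))) (pairing-involutive _) ⟩
      pairing (double (actLetter φ (s , b)) (double (evalWord φ w) (pairing y)))
        ≡⟨ cong pairing (double-∘ (actLetter φ (s , b)) (evalWord φ w) (pairing y)) ⟩
      pairing (double (evalWord φ ((s , b) ∷ w)) (pairing y)) ∎
      where
      open ≡-Reasoning
      actLetter-twistedDouble : ∀ b z → actLetter (twistedDouble ∘ φ) (s , b) z ≡
                                        pairing (double (actLetter φ (s , b)) (pairing z))
      actLetter-twistedDouble true  z = refl
      actLetter-twistedDouble false z = refl

    countFix-twistedDouble : ∀ c w → countFix c (evalWord (twistedDouble ∘ φ) w) ≡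
                                     countFix c (evalWord φ w) + countFix c (evalWord φ w)
    countFix-twistedDouble c w = begin
      countFix c (evalWord (twistedDouble ∘ φ) w)
        ≡⟨ count-cong (λ y → cong (λ z → c (does (z ≟ y))) (evalWord-twistedDouble w y)) ⟩
      countFix c (λ y → pairing (double (evalWord φ w) (pairing y)))
        ≡⟨ countFix-conjugate c pairingPerm (double (evalWord φ w)) ⟩
      countFix c (double (evalWord φ w))
        ≡⟨ countFix-double c (evalWord φ w) ⟩
      countFix c (evalWord φ w) + countFix c (evalWord φ w) ∎
      where open ≡-Reasoning

-- Symmetrising one almost action

module Symmetrisation {k N : ℕ} (φ : Fin k → Permutation′ N) (τ : Fin k) where

  open TwoCopies N

  t : Fin N → Fin N
  t = φ τ ⟨$⟩ʳ_

  commutator : Fin k → ℕ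
  commutator s = dist (t ∘ (φ s ⟨$⟩ʳ_)) ((φ s ⟨$⟩ʳ_) ∘ t)

  -- Small when t is nearly a fixed-point-free involution commuting with every φ s;
  -- the construction changes at most 4 · τDefect points per generator.
  τDefect : ℕ
  τDefect = (moved (t ∘ t) + fixed t) + sum (map commutator (allFin k))

  offCycle : Fin N → Bool
  offCycle x = not (does (t (t x) ≟ x)) ∨ does (t x ≟ x)

  offCycles : ℕ
  offCycles = count offCycle

  offCycles≤ : offCycles ≤ moved (t ∘ t) + fixed t
  offCycles≤ = count-∨ (λ x → not (does (t (t x) ≟ x))) (λ x → does (t x ≟ x))

  onCycle : ∀ {x} → offCycle x ≡ false → t (t x) ≡ x × t x ≢ x
  onCycle {x} on with t (t x) ≟ x | t x ≟ x | on
  ... | yes ttx≡x | no tx≢x | _ = ttx≡x , tx≢x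

  tOn2Cycles : Fin N → Fin N
  tOn2Cycles x with t (t x) ≟ x
  ... | yes _ = t x
  ... | no  _ = x

  tOn2Cycles≡t : ∀ {x} → t (t x) ≡ x → tOn2Cycles x ≡ t x
  tOn2Cycles≡t {x} ttx≡x with t (t x) ≟ x
  ... | yes _    = refl
  ... | no ttx≢x = contradiction ttx≡x ttx≢x

  tOn2Cycles-involutive : ∀ x → tOn2Cycles (tOn2Cycles x) ≡ x
  tOn2Cycles-involutive x with t (t x) ≟ x
  ... | yes ttx≡x = trans (tOn2Cycles≡t (cong t ttx≡x)) ttx≡x
  ... | no  ttx≢x with t (t x) ≟ x
  ...   | yes ttx≡x = contradiction ttx≡x ttx≢x
  ...   | no  _     = refl

  open Pairing tOn2Cycles tOn2Cycles-involutive

  tOn2Cycles-moves : ∀ {x} → t (t x) ≡ x → t x ≢ x → tOn2Cycles x ≢ x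
  tOn2Cycles-moves ttx≡x tx≢x = tx≢x ∘ trans (sym (tOn2Cycles≡t ttx≡x))

  freeDouble-onCycle-↑ˡ : ∀ {x} → offCycle x ≡ false → freeDouble (x ↑ˡ N) ≡ t x ↑ˡ N
  freeDouble-onCycle-↑ˡ on with onCycle on
  ... | ttx≡x , tx≢x =
    trans (freeDouble-↑ˡ _ (tOn2Cycles-moves ttx≡x tx≢x)) (cong (_↑ˡ N) (tOn2Cycles≡t ttx≡x))

  freeDouble-onCycle-↑ʳ : ∀ {x} → offCycle x ≡ false → freeDouble (N ↑ʳ x) ≡ N ↑ʳ t x
  freeDouble-onCycle-↑ʳ on with onCycle on
  ... | ttx≡x , tx≢x =
    trans (freeDouble-↑ʳ _ (tOn2Cycles-moves ttx≡x tx≢x)) (cong (N ↑ʳ_) (tOn2Cycles≡t ttx≡x))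

  dist-freeDouble : dist freeDouble (double t) ≤ offCycles + offCycles
  dist-freeDouble = ≤-trans (≤-reflexive (count-↑ {N} {N} (λ y → freeDouble y ≢ᵇ double t y))) (+-mono-≤
    (count-mono λ x → ≢ᵇ-blames (offCycle x) λ on →
      trans (freeDouble-onCycle-↑ˡ on) (sym (double-↑ˡ t x)))
    (count-mono λ x → ≢ᵇ-blames (offCycle x) λ on →
      trans (freeDouble-onCycle-↑ʳ on) (sym (double-↑ʳ t x))))

  dist-double-freeDouble : (π : Permutation′ N) → let g = π ⟨$⟩ʳ_ in
    dist (double g ∘ freeDouble) (freeDouble ∘ double g) ≤
    ((offCycles + offCycles) + dist (t ∘ g) (g ∘ t)) + ((offCycles + offCycles) + dist (t ∘ g) (g ∘ t))
  dist-double-freeDouble π =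
    ≤-trans (≤-reflexive (count-↑ {N} {N} (λ y → double g (freeDouble y) ≢ᵇ freeDouble (double g y))))
      (+-mono-≤ (≤-trans (count-mono (λ x → ≢ᵇ-blames₃ (offCycle x) (offCycle (g x)) _ (commutes-↑ˡ x)))
                         offCycleOrCommutator)
                (≤-trans (count-mono (λ x → ≢ᵇ-blames₃ (offCycle x) (offCycle (g x)) _ (commutes-↑ʳ x)))
                         offCycleOrCommutator))
    where
    g : Fin N → Fin N
    g = π ⟨$⟩ʳ_
    commutes-↑ˡ : ∀ x → offCycle x ≡ false → offCycle (g x) ≡ false → t (g x) ≢ᵇ g (t x) ≡ false →
                  double g (freeDouble (x ↑ˡ N)) ≡ freeDouble (double g (x ↑ˡ N))
    commutes-↑ˡ x on on′ tg≡gt = begin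
      double g (freeDouble (x ↑ˡ N))  ≡⟨ cong (double g) (freeDouble-onCycle-↑ˡ on) ⟩
      double g (t x ↑ˡ N)             ≡⟨ double-↑ˡ g (t x) ⟩
      g (t x) ↑ˡ N                    ≡⟨ cong (_↑ˡ N) (≢ᵇ-false⇒≡ tg≡gt) ⟨
      t (g x) ↑ˡ N                    ≡⟨ freeDouble-onCycle-↑ˡ on′ ⟨
      freeDouble (g x ↑ˡ N)           ≡⟨ cong freeDouble (double-↑ˡ g x) ⟨
      freeDouble (double g (x ↑ˡ N))  ∎
      where open ≡-Reasoning
    commutes-↑ʳ : ∀ x → offCycle x ≡ false → offCycle (g x) ≡ false → t (g x) ≢ᵇ g (t x) ≡ false →
                  double g (freeDouble (N ↑ʳ x)) ≡ freeDouble (double g (N ↑ʳ x))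
    commutes-↑ʳ x on on′ tg≡gt = begin
      double g (freeDouble (N ↑ʳ x))  ≡⟨ cong (double g) (freeDouble-onCycle-↑ʳ on) ⟩
      double g (N ↑ʳ t x)             ≡⟨ double-↑ʳ g (t x) ⟩
      N ↑ʳ g (t x)                    ≡⟨ cong (N ↑ʳ_) (≢ᵇ-false⇒≡ tg≡gt) ⟨
      N ↑ʳ t (g x)                    ≡⟨ freeDouble-onCycle-↑ʳ on′ ⟨
      freeDouble (N ↑ʳ g x)           ≡⟨ cong freeDouble (double-↑ʳ g x) ⟨
      freeDouble (double g (N ↑ʳ x))  ∎
      where open ≡-Reasoning
    offCycleOrCommutator : count (λ x → (offCycle x ∨ offCycle (g x)) ∨ (t (g x) ≢ᵇ g (t x))) ≤
                           (offCycles + offCycles) + dist (t ∘ g) (g ∘ t)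
    offCycleOrCommutator = ≤-trans (count-∨ (λ x → offCycle x ∨ offCycle (g x)) (λ x → t (g x) ≢ᵇ g (t x)))
      (+-monoˡ-≤ _ (≤-trans (count-∨ offCycle (offCycle ∘ g))
                            (≤-reflexive (cong (offCycles +_) (count-permute π offCycle)))))

  open FirstReturn neg neg-involutive

  φ̂ : Fin k → Permutation′ (N + N)
  φ̂ = twistedDouble ∘ φ

  ψ : Fin k → Permutation′ (N + N)
  ψ s with s ≟ τ
  ... | yes _ = negPerm
  ... | no  _ = firstReturnPerm (φ̂ s)

  ψ-τ : ∀ y → ψ τ ⟨$⟩ʳ y ≡ neg y
  ψ-τ y with τ ≟ τ
  ... | yes _  = refl
  ... | no τ≢τ = contradiction refl τ≢τ

  ψ-neg : ∀ s y → ψ s ⟨$⟩ʳ neg y ≡ neg (ψ s ⟨$⟩ʳ y)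
  ψ-neg s y with s ≟ τ
  ... | yes _ = refl
  ... | no  _ = firstReturn-comm (φ̂ s) y

  private
    within-budget : ∀ s →
      ((offCycles + offCycles) + commutator s) + ((offCycles + offCycles) + commutator s) ≤ 4 * τDefect
    within-budget s = begin
      ((o + o) + c) + ((o + o) + c)            ≤⟨ +-mono-≤ bound bound ⟩
      ((B + B) + C) + ((B + B) + C)            ≤⟨ m≤m+n _ (C + C) ⟩
      ((B + B) + C) + ((B + B) + C) + (C + C)  ≡⟨ regroup B C ⟩
      4 * (B + C)                              ∎
      where
      open ≤-Reasoning
      o c B C : ℕ
      o = offCycles
      c = commutator s
      B = moved (t ∘ t) + fixed t
      C = sum (map commutator (allFin k))
      bound : (o + o) + c ≤ (B + B) + C
      bound = +-mono-≤ (+-mono-≤ offCycles≤ offCycles≤) (∈⇒≤sum (∈-map⁺ commutator (∈-allFin s)))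
      regroup : ∀ B C → ((B + B) + C) + ((B + B) + C) + (C + C) ≡ 4 * (B + C)
      regroup = solve 2 (λ B C → ((B :+ B) :+ C) :+ ((B :+ B) :+ C) :+ (C :+ C) := con 4 :* (B :+ C)) refl

  dist-ψ : ∀ s → dist (ψ s ⟨$⟩ʳ_) (φ̂ s ⟨$⟩ʳ_) ≤ 4 * τDefect
  dist-ψ s with s ≟ τ
  ... | yes refl = begin
    dist neg (λ y → pairing (double t (pairing y)))
      ≡⟨ dist-cong (λ y → trans (cong neg (sym (pairing-involutive y))) (neg-pairing (pairing y)))
                   (λ _ → refl) ⟩
    dist (λ y → pairing (freeDouble (pairing y))) (λ y → pairing (double t (pairing y)))
      ≡⟨ dist-conjugate pairingPerm freeDouble (double t) ⟩
    dist freeDouble (double t)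
      ≤⟨ dist-freeDouble ⟩
    offCycles + offCycles
      ≤⟨ ≤-trans (m≤m+n _ _) (m≤m+n _ _) ⟩
    ((offCycles + offCycles) + commutator τ) + ((offCycles + offCycles) + commutator τ)
      ≤⟨ within-budget τ ⟩
    4 * τDefect ∎
    where open ≤-Reasoning
  ... | no _ = begin
    dist (firstReturn h) h
      ≤⟨ dist-firstReturn (φ̂ s) ⟩
    dist (λ y → h (neg y)) (λ y → neg (h y))
      ≡⟨ dist-cong (λ y → cong (pairing ∘ double g) (pairing-neg y)) (neg-pairing ∘ double g ∘ pairing) ⟩
    dist (λ y → pairing (double g (freeDouble (pairing y))))
         (λ y → pairing (freeDouble (double g (pairing y))))
      ≡⟨ dist-conjugate pairingPerm (double g ∘ freeDouble) (freeDouble ∘ double g) ⟩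
    dist (double g ∘ freeDouble) (freeDouble ∘ double g)
      ≤⟨ dist-double-freeDouble (φ s) ⟩
    ((offCycles + offCycles) + commutator s) + ((offCycles + offCycles) + commutator s)
      ≤⟨ within-budget s ⟩
    4 * τDefect ∎
    where
    open ≤-Reasoning
    g h : Fin _ → Fin _
    g = φ s ⟨$⟩ʳ_
    h = φ̂ s ⟨$⟩ʳ_

  dist-letter : ∀ l → dist (actLetter ψ l) (actLetter φ̂ l) ≤ 4 * τDefect
  dist-letter (s , true)  = dist-ψ s
  dist-letter (s , false) = ≤-trans (≤-reflexive (dist-inverse (ψ s) (φ̂ s))) (dist-ψ s)

  dist-word : ∀ w → dist (evalWord ψ w) (evalWord φ̂ w) ≤ length w * (4 * τDefect)
  dist-word []      = ≤-reflexive (dist-≗ {f = evalWord ψ []} {g = evalWord φ̂ []} (λ _ → refl))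
  dist-word (l ∷ w) = begin
    dist (evalWord ψ (l ∷ w)) (evalWord φ̂ (l ∷ w))
      ≡⟨ dist-cong (λ y → cong (actLetter ψ l) (wordPerm-evalWord ψ w y)) (λ _ → refl) ⟨
    dist (λ y → actLetter ψ l (wordPerm ψ w ⟨$⟩ʳ y)) (λ y → actLetter φ̂ l (evalWord φ̂ w y))
      ≤⟨ dist-∘ (wordPerm ψ w) (actLetter ψ l) (actLetter φ̂ l) (evalWord φ̂ w) ⟩
    dist (wordPerm ψ w ⟨$⟩ʳ_) (evalWord φ̂ w) + dist (actLetter ψ l) (actLetter φ̂ l)
      ≤⟨ +-mono-≤ (≤-trans (≤-reflexive (dist-cong (wordPerm-evalWord ψ w) (λ _ → refl))) (dist-word w))
                  (dist-letter l) ⟩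
    length w * (4 * τDefect) + 4 * τDefect
      ≡⟨ +-comm _ (4 * τDefect) ⟩
    length (l ∷ w) * (4 * τDefect) ∎
    where open ≤-Reasoning

  countFix-ψ : ∀ c w → countFix c (evalWord ψ w) ≤
               length w * (4 * τDefect) + (countFix c (evalWord φ w) + countFix c (evalWord φ w))
  countFix-ψ c w = begin
    countFix c (evalWord ψ w)
      ≤⟨ countFix-triangle c (evalWord ψ w) (evalWord φ̂ w) ⟩
    dist (evalWord ψ w) (evalWord φ̂ w) + countFix c (evalWord φ̂ w)
      ≤⟨ +-mono-≤ (dist-word w) (≤-reflexive (countFix-twistedDouble φ c w)) ⟩
    length w * (4 * τDefect) + (countFix c (evalWord φ w) + countFix c (evalWord φ w)) ∎
    where open ≤-Reasoning

-- Symmetrising a sofic approximation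

module _ {R : List (Word k)} {τ : Fin k} {N : ℕ → ℕ} {φ : (n : ℕ) → Fin k → Permutation′ (N n)}
         (approx : IsCountingSoficApprox R N φ)
         (τ²∈⟨⟨R⟩⟩ : InNormalClosure R (letter τ ++ letter τ))
         (τ∉⟨⟨R⟩⟩ : ¬ InNormalClosure R (letter τ))
         (τ-central : ∀ w → (letter τ ++ w) ≈⟨ R ⟩ (w ++ letter τ)) where

  open IsCountingSoficApprox approx

  private
    open module Symmetrised n = Symmetrisation (φ n) τ using (τDefect; ψ)

  τDefect-negligible : Negligible N τDefect
  τDefect-negligible = negligible-+
    (negligible-+ (negligible-≤ (λ n → dist-evalWord (φ n) τ²∈⟨⟨R⟩⟩)
                                (negligible-* (relatorCount τ²∈⟨⟨R⟩⟩) relators))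
                  (separating (letter τ) τ∉⟨⟨R⟩⟩))
    (negligible-sum (allFin k) λ {s} _ →
      negligible-≤ (λ n → dist-evalWord (φ n) (τ-central (letter s)))
                   (negligible-* (relatorCount (τ-central (letter s))) relators))

  symmetrised : IsCountingSoficApprox R (λ n → N n + N n) ψ
  symmetrised = record
    { nonempty   = λ n → ≤-trans (nonempty n) (N≤N+N n)
    ; relators   = negligible-weaken N≤N+N (negligible-sum R λ {r} r∈R →
                     transfer not r (negligible-≤ (λ n → moved≤defect (φ n) r∈R) relators))
    ; separating = λ w w∉⟨⟨R⟩⟩ → negligible-weaken N≤N+N (transfer id w (separating w w∉⟨⟨R⟩⟩))
    }
    where
    N≤N+N : ∀ n → N n ≤ N n + N n
    N≤N+N n = m≤m+n (N n) (N n)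
    transfer : ∀ c w → Negligible N (λ n → countFix c (evalWord (φ n) w)) →
               Negligible N (λ n → countFix c (evalWord (ψ n) w))
    transfer c w small = negligible-≤ (λ n → Symmetrised.countFix-ψ n c w)
      (negligible-+ (negligible-* (length w) (negligible-* 4 τDefect-negligible))
                    (negligible-+ small small))

corollary2p5 : (k : ℕ) (R : List (Word k)) (τ : Fin k) →
    IsSofic R →
    InNormalClosure R (letter τ Data.List.++ letter τ) →
    ¬ InNormalClosure R (letter τ) →
    (∀ (w : Word k) → (letter τ Data.List.++ w) ≈⟨ R ⟩ (w Data.List.++ letter τ)) →
    Σ (ℕ → ℕ) λ m → Σ ((n : ℕ) → Fin k → Permutation′ (m n + m n)) λ ψ →
      IsSoficApprox R (λ n → m n + m n) ψ ×
      (∀ n (x : Fin (m n + m n)) → ψ n τ ⟨$⟩ʳ x ≡ negId {m n} x) ×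
      (∀ n (s : Fin k) (x : Fin (m n + m n)) → ψ n s ⟨$⟩ʳ negId {m n} x ≡ negId {m n} (ψ n s ⟨$⟩ʳ x))
corollary2p5 k R τ (N , φ , approx) τ²∈⟨⟨R⟩⟩ τ∉⟨⟨R⟩⟩ τ-central =
  N , ψ , toIsSoficApprox (symmetrised (fromIsSoficApprox approx) τ²∈⟨⟨R⟩⟩ τ∉⟨⟨R⟩⟩ τ-central) , ψ-τ , ψ-neg
  where open module Symmetrised n = Symmetrisation (φ n) τ using (ψ; ψ-τ; ψ-neg)
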